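{- Let $n\ge1$. Suppose $\mathrm{key}_m=0^l\sigma w$ and $\mathrm{key}_r=z\sigma w$ are key-words, where $\sigma$ is a symbol and $z\neq 0^{n-|\sigma w|}$. Then every element of the cycle $C_r$ precedes $\sigma w0^l$, i.e. $u<\sigma w0^l$ for all $u\in C_r$.
   Context: Words are over $\mathbb N$; $\sigma^t$ denotes $t$ repetitions of $\sigma$, $|w|$ the length. A rotation of $xy$ is $yx$. For words of equal length, $w_1\le_{\mathrm{colex}} w_2$ means the reversal of $w_1$ is lexicographically $\le$ the reversal of $w_2$. A key-word is a length-$n$ word colex-maximal among its rotations. For $k\ge1$ let $c(n,k)$ be the number of key-words in $[k]^n$ ($[k]=\{0,\dots,k-1\}$), listed in increasing colex order $\mathrm{key}_0<\cdots<\mathrm{key}_{c(n,k)-1}$ (consistently in $k$). Cycles: $C_0=(0^n)$. For $m\ge1$ write $\mathrm{key}_m=0^l(\sigma+1)w$; $C_m$ is the sequence of all distinct rotations of $\mathrm{key}_m$, starting with $\mathrm{first}(C_m)=w0^l(\sigma+1)$, in which each word $\tau w'$ is followed by $w'\tau$, ending with $\mathrm{last}(C_m)=(\sigma+1)w0^l$. Construction: $D_0=(0^n)$; writing $\mathrm{key}_{m+1}=0^l(\sigma+1)w$, $D_{m+1}$ is obtained from $D_m$ by inserting the sequence $C_{m+1}$ immediately after the word $\sigma w0^l$ of $D_m$. $D(n,k)=D_{c(n,k)-1}$. For length-$n$ words $u,v$, $u<v$ means $u$ appears before $v$ in $D(n,k)$ for some (equivalently any) $k$ with $u,v\in[k]^n$.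 -}

module Defs where

open import Data.Nat using (ℕ; zero; suc; pred; _<_; _+_; _<?_)
open import Data.Nat.Properties using (_≟_)
open import Data.Bool using (Bool; true; false; if_then_else_; _∧_; _∨_; T)
open import Data.List using (List; []; _∷_; _++_; map; concatMap; filter; foldl; drop; take;
  length; reverse; replicate; upTo)
open import Data.Product using (∃; ∃-syntax; _×_)
open import Relation.Binary.PropositionalEquality using (_≡_)
open import Relation.Nullary.Decidable using (⌊_⌋; yes; no)
open import Data.Bool.Properties using (T?)
open import Data.List.Properties using (≡-dec)

Word : Set
Word = List ℕ

_==ʷ_ : Word → Word → Bool
u ==ʷ v = ⌊ ≡-dec _≟_ u v ⌋

lexLeq : Word → Word → Bool
lexLeq [] _ = true
lexLeq (_ ∷ _) [] = false
lexLeq (x ∷ xs) (y ∷ ys) with x ≟ y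
... | yes _ = lexLeq xs ys
... | no _ = ⌊ x <? y ⌋

colexLeq : Word → Word → Bool
colexLeq u v = lexLeq (reverse u) (reverse v)

rotations : Word → List Word
rotations w = map (λ i → drop i w ++ take i w) (upTo (length w))

isKey : Word → Bool
isKey w = allB (rotations w)
  where
  allB : List Word → Bool
  allB [] = true
  allB (r ∷ rs) = colexLeq r w ∧ allB rs

IsKeyWord : Word → Set
IsKeyWord w = T (isKey w)

lexWords : ℕ → ℕ → List Word
lexWords zero k = [] ∷ []
lexWords (suc n) k = concatMap (λ a → map (a ∷_) (lexWords n k)) (upTo k)

colexWords : ℕ → ℕ → List Word
colexWords n k = map reverse (lexWords n k)

-- key_0 < key_1 < … < key_{c(n,k)-1}: key-words in [k]^n in increasing colex order
keys : ℕ → ℕ → List Word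
keys n k = filter (λ w → T? (isKey w)) (colexWords n k)

rotL : Word → Word
rotL [] = []
rotL (x ∷ xs) = xs ++ x ∷ []

rotL^ : ℕ → Word → Word
rotL^ zero w = w
rotL^ (suc i) w = rotL (rotL^ i w)

leadingZeros : Word → ℕ
leadingZeros [] = 0
leadingZeros (zero ∷ xs) = suc (leadingZeros xs)
leadingZeros (suc _ ∷ _) = 0

-- number of distinct rotations: least p ≥ 1 with rotL^ p w ≡ w (p ≤ |w|)
period : Word → ℕ
period w = go 1 (length w)
  where
  go : ℕ → ℕ → ℕ
  go p zero = p
  go p (suc fuel) = if rotL^ p w ==ʷ w then p else go (suc p) fuel

-- C(0^n) = (0^n);  for key = 0^l (σ+1) w it is the
-- sequence of all distinct rotations starting with w 0^l (σ+1) = rotL^(l+1) key,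
-- each word followed by its left rotation, ending with (σ+1) w 0^l.
cycle : Word → List Word
cycle key with leadingZeros key ≟ length key
... | yes _ = key ∷ []
... | no _ =
  map (λ i → rotL^ (suc (leadingZeros key) + i) key) (upTo (period key))

-- for key = 0^l (σ+1) w, the word σ w 0^l after which C(key) is inserted
target : Word → Word
target key with drop (leadingZeros key) key
... | [] = key
... | s ∷ w = pred s ∷ w ++ replicate (leadingZeros key) 0

insertAfter : Word → List Word → List Word → List Word
insertAfter t c [] = []
insertAfter t c (x ∷ xs) = if x ==ʷ t then x ∷ (c ++ xs) else x ∷ insertAfter t c xs

-- D(n,k) = D_{c(n,k)-1}, with D_0 = (0^n) and D_{m+1} obtained by inserting C_{m+1}
-- immediately after σ w 0^l, where key_{m+1} = 0^l (σ+1) w.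
D : ℕ → ℕ → List Word
D n k = foldl (λ Dm key → insertAfter (target key) (cycle key) Dm)
              (replicate n 0 ∷ []) (drop 1 (keys n k))

Before : List Word → Word → Word → Set
Before s u v = ∃[ xs ] ∃[ ys ] ∃[ zs ] (s ≡ xs ++ (u ∷ ys) ++ (v ∷ zs))

-- Write the key-word as z σ w = 0^a (t+1) y σ w.  Decreasing its first nonzero letter gives a
-- colex-smaller key-word K′ = 0^a t y σ w, hence one inserted earlier, and the word after which
-- C(z σ w) is inserted, t y σ w 0^a, is the rotation of K′ by a.  If 0^a t y is zero, then
-- K′ = 0^l σ w and, as a < l, that rotation precedes σ w 0^l = rotL^ l K′ inside C(K′); otherwise it
-- lies in C(K′), which precedes σ w 0^l by induction on the letter sum of z.  Insertions never
-- reorder the words already present, so C(z σ w), inserted right after that rotation, stays before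
-- σ w 0^l.
module Submission where

open import Defs
open import Data.Nat using (ℕ; zero; suc; _≤_; _<_; _+_; _∸_; pred; z≤n; s≤s; s≤s⁻¹; z<s)
open import Data.Nat.Properties
open import Data.Bool using (Bool; true; T; _∧_; if_then_else_)
open import Data.Bool.Properties using (T-∧; T?)
open import Data.Product using (∃₂; ∃-syntax; _×_; _,_; proj₁; proj₂)
open import Data.List using (List; []; _∷_; _∷ʳ_; _++_; filter; concatMap; foldl; length; replicate; applyUpTo; map; upTo; take; drop; reverse)
open import Data.List.Properties using (++-assoc; ++-identityʳ; ≡-dec; map-applyUpTo; length-replicate; reverse-++; reverse-involutive; length-reverse; length-++; length-++-comm; length-++-≤ʳ; take++drop≡id; unfold-reverse; ++-cancelˡ; ∷-injectiveˡ; ∷-injectiveʳ; filter-accept; foldl-++; foldl-∷ʳ)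
open import Data.List.Membership.Propositional using (_∈_; find)
open import Data.List.Membership.Propositional.Properties using (∈-applyUpTo⁺; ∈-++⁺ˡ; ∈-++⁺ʳ; ∈-∃++; ∈-map⁺; ∈-map⁻; ∈-upTo⁺; ∈-upTo⁻; ∈-concatMap⁺; ∈-concatMap⁻; ∈-filter⁺; ∈-filter⁻; ∈-++⁻)
open import Data.List.Relation.Unary.All using (All; []; _∷_; lookup; tabulate)
open import Data.List.Relation.Unary.Any using (here; there)
import Data.List.Relation.Unary.Any as Any
import Data.List.Relation.Unary.Any.Properties as Any
open import Data.List.Relation.Unary.All.Properties using (++⁺; ++⁻ˡ; ++⁻ʳ)
import Data.List.Relation.Unary.All as All
import Data.List.Relation.Unary.All.Properties as All
open import Data.List.Relation.Unary.AllPairs using (AllPairs; []; _∷_)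
import Data.List.Relation.Unary.AllPairs as AllPairs
import Data.List.Relation.Unary.AllPairs.Properties as AllPairs
open import Data.Sum using (_⊎_; inj₁; inj₂)
open import Data.List.Reverse using (Reverse; []; _∶_∶ʳ_; reverseView)
open import Data.Nat.ListAction using (sum)
open import Data.Empty using (⊥-elim)
open import Function using (id; _∘_; _⇔_; mk⇔; Equivalence)
open import Relation.Nullary using (¬_; yes; no)
open import Relation.Binary.PropositionalEquality using (_≡_; _≢_; refl; sym; trans; cong; cong₂; subst; subst₂; module ≡-Reasoning)

infix 4 _≼_ _≼ᶜ_

_≼_ : Word → Word → Set
u ≼ v = T (lexLeq u v)

_≼ᶜ_ : Word → Word → Set
u ≼ᶜ v = T (colexLeq u v)

lexLeq-∷ : ∀ x (xs ys : Word) → lexLeq (x ∷ xs) (x ∷ ys) ≡ lexLeq xs ys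
lexLeq-∷ x xs ys with x ≟ x
... | yes _ = refl
... | no x≢x = ⊥-elim (x≢x refl)

lexLeq-++ : ∀ (p xs ys : Word) → lexLeq (p ++ xs) (p ++ ys) ≡ lexLeq xs ys
lexLeq-++ [] xs ys = refl
lexLeq-++ (x ∷ p) xs ys = trans (lexLeq-∷ x (p ++ xs) (p ++ ys)) (lexLeq-++ p xs ys)

≼-refl : ∀ xs → xs ≼ xs
≼-refl [] = _
≼-refl (x ∷ xs) = subst T (sym (lexLeq-∷ x xs xs)) (≼-refl xs)

≼-head : ∀ {x y} {xs ys : Word} → x ∷ xs ≼ y ∷ ys → x ≤ y
≼-head {x} {y} h with x ≟ y
... | yes x≡y = ≤-reflexive x≡y
... | no _ with x <? y
...   | yes x<y = <⇒≤ x<y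
...   | no _ = ⊥-elim h

≼-< : ∀ {x y} (xs ys : Word) → x < y → x ∷ xs ≼ y ∷ ys
≼-< {x} {y} xs ys x<y with x ≟ y
... | yes refl = ⊥-elim (<-irrefl refl x<y)
... | no _ with x <? y
...   | yes _ = _
...   | no x≮y = x≮y x<y

lexLeq-distinct-prefix : ∀ (p q xs ys xs′ ys′ : Word) → length p ≡ length q → p ≢ q →
  lexLeq (p ++ xs) (q ++ ys) ≡ lexLeq (p ++ xs′) (q ++ ys′)
lexLeq-distinct-prefix [] [] _ _ _ _ _ p≢q = ⊥-elim (p≢q refl)
lexLeq-distinct-prefix (x ∷ p) (y ∷ q) xs ys xs′ ys′ |p|≡|q| p≢q with x ≟ y
... | yes refl = lexLeq-distinct-prefix p q xs ys xs′ ys′ (suc-injective |p|≡|q|) (p≢q ∘ cong (x ∷_))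
... | no _ = refl

rotL^-suc : ∀ i (x : Word) → rotL^ (suc i) x ≡ rotL^ i (rotL x)
rotL^-suc zero x = refl
rotL^-suc (suc i) x = cong rotL (rotL^-suc i x)

rotL^-+ : ∀ i j (x : Word) → rotL^ (i + j) x ≡ rotL^ i (rotL^ j x)
rotL^-+ zero j x = refl
rotL^-+ (suc i) j x = cong rotL (rotL^-+ i j x)

rotL^-++ : ∀ (A B : Word) → rotL^ (length A) (A ++ B) ≡ B ++ A
rotL^-++ [] B = sym (++-identityʳ B)
rotL^-++ (a ∷ A) B = begin
  rotL^ (suc (length A)) (a ∷ A ++ B)   ≡⟨ rotL^-suc (length A) (a ∷ A ++ B) ⟩
  rotL^ (length A) ((A ++ B) ++ a ∷ [])  ≡⟨ cong (rotL^ (length A)) (++-assoc A B (a ∷ [])) ⟩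
  rotL^ (length A) (A ++ B ++ a ∷ [])    ≡⟨ rotL^-++ A (B ++ a ∷ []) ⟩
  (B ++ a ∷ []) ++ A                     ≡⟨ ++-assoc B (a ∷ []) A ⟩
  B ++ a ∷ A                             ∎
  where open ≡-Reasoning

rotL^-length : ∀ (x : Word) → rotL^ (length x) x ≡ x
rotL^-length x = trans (cong (rotL^ (length x)) (sym (++-identityʳ x))) (rotL^-++ x [])

rotL^-periodic : ∀ {p} {x : Word} → rotL^ p x ≡ x → ∀ i → rotL^ (p + i) x ≡ rotL^ i x
rotL^-periodic {p} {x} px i = begin
  rotL^ (p + i) x        ≡⟨ cong (λ j → rotL^ j x) (+-comm p i) ⟩
  rotL^ (i + p) x        ≡⟨ rotL^-+ i p x ⟩
  rotL^ i (rotL^ p x)    ≡⟨ cong (rotL^ i) px ⟩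
  rotL^ i x              ∎
  where open ≡-Reasoning

-- `period` and `isKey` compute with local functions that cannot be named outside Defs.  They are
-- specified by their defining equations, and the local function is recovered by unification at the
-- use site once all its arguments are abstracted to variables, which the `with`s below arrange.
record IsPeriodSearch (w : Word) (search : ℕ → ℕ → ℕ) : Set where
  field
    found : ∀ p → search p 0 ≡ p
    step  : ∀ p f → search p (suc f) ≡ (if rotL^ p w ==ʷ w then p else search (suc p) f)

periodSearch-periodic : ∀ {w search} → IsPeriodSearch w search →
  ∀ p m → rotL^ (p + pred m) w ≡ w → p ≤ search p m × rotL^ (search p m) w ≡ w
periodSearch-periodic {w} s p zero periodic rewrite IsPeriodSearch.found s p =
  ≤-refl , subst (λ i → rotL^ i w ≡ w) (+-identityʳ p) periodic
periodSearch-periodic {w} s p (suc f) periodic rewrite IsPeriodSearch.step s p f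
  with ≡-dec _≟_ (rotL^ p w) w
... | yes p-periodic = ≤-refl , p-periodic
periodSearch-periodic {w} s p (suc zero) periodic | no p-aperiodic =
  ⊥-elim (p-aperiodic (subst (λ i → rotL^ i w ≡ w) (+-identityʳ p) periodic))
periodSearch-periodic {w} s p (suc (suc f)) periodic | no _
  with periodSearch-periodic s (suc p) (suc f) (subst (λ i → rotL^ i w ≡ w) (+-suc p f) periodic)
... | p<search , periodic′ = <⇒≤ p<search , periodic′

rotL^-suc-pred-length : ∀ (w : Word) → rotL^ (suc (pred (length w))) w ≡ w
rotL^-suc-pred-length [] = refl
rotL^-suc-pred-length w@(_ ∷ _) = rotL^-length w

period-periodic : ∀ w → 0 < period w × rotL^ (period w) w ≡ w
period-periodic w
  with periodSearch-periodic {w} record { found = λ _ → refl ; step = λ _ _ → refl } | 1 in 1≡p | length w in |w|≡m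
... | spec | p | m = spec p m
  (subst₂ (λ i j → rotL^ (i + pred j) w ≡ w) 1≡p |w|≡m (rotL^-suc-pred-length w))

replicate-+ : ∀ m n (x : ℕ) → replicate (m + n) x ≡ replicate m x ++ replicate n x
replicate-+ zero n x = refl
replicate-+ (suc m) n x = cong (x ∷_) (replicate-+ m n x)

IsZero : Word → Set
IsZero = All (_≡ 0)

data ZeroView : Word → Set where
  zeros   : ∀ n → ZeroView (replicate n 0)
  nonzero : ∀ a t Y → ZeroView (replicate a 0 ++ suc t ∷ Y)

zeroView : ∀ x → ZeroView x
zeroView [] = zeros 0
zeroView (suc t ∷ Y) = nonzero 0 t Y
zeroView (zero ∷ x) with zeroView x
... | zeros n = zeros (suc n)
... | nonzero a t Y = nonzero (suc a) t Y

IsZero-replicate : ∀ n → IsZero (replicate n 0)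
IsZero-replicate zero = []
IsZero-replicate (suc n) = refl ∷ IsZero-replicate n

IsZero⇒replicate : ∀ {x m} → IsZero x → length x ≡ m → x ≡ replicate m 0
IsZero⇒replicate [] refl = refl
IsZero⇒replicate (refl ∷ zs) refl = cong (0 ∷_) (IsZero⇒replicate zs refl)

leadingZeros-nonzero : ∀ a t Y → leadingZeros (replicate a 0 ++ suc t ∷ Y) ≡ a
leadingZeros-nonzero zero t Y = refl
leadingZeros-nonzero (suc a) t Y = cong suc (leadingZeros-nonzero a t Y)

leadingZeros-nonzero≢length : ∀ a t Y → let x = replicate a 0 ++ suc t ∷ Y in leadingZeros x ≢ length x
leadingZeros-nonzero≢length zero t Y ()
leadingZeros-nonzero≢length (suc a) t Y = leadingZeros-nonzero≢length a t Y ∘ suc-injective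

leadingZeros-replicate-++ : ∀ a X → a ≤ leadingZeros (replicate a 0 ++ X)
leadingZeros-replicate-++ zero X = z≤n
leadingZeros-replicate-++ (suc a) X = s≤s (leadingZeros-replicate-++ a X)

data Precedes (u v : Word) : List Word → Set where
  here  : ∀ {s} → v ∈ s → Precedes u v (u ∷ s)
  there : ∀ {x s} → Precedes u v s → Precedes u v (x ∷ s)

precedes-applyUpTo : ∀ (f : ℕ → Word) {i j n} → i < j → j < n → Precedes (f i) (f j) (applyUpTo f n)
precedes-applyUpTo f {zero} {suc j} {suc n} _ (s≤s j<n) = here (∈-applyUpTo⁺ (f ∘ suc) j<n)
precedes-applyUpTo f {suc i} {suc j} {suc n} (s≤s i<j) (s≤s j<n) = there (precedes-applyUpTo (f ∘ suc) i<j j<n)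

module Cycle (L t : ℕ) (Y : Word) where

  x : Word
  x = replicate L 0 ++ suc t ∷ Y

  cycle-applyUpTo : cycle x ≡ applyUpTo (λ i → rotL^ (suc L + i) x) (period x)
  cycle-applyUpTo with leadingZeros x ≟ length x
  ... | yes L≡|x| = ⊥-elim (leadingZeros-nonzero≢length L t Y L≡|x|)
  ... | no _ rewrite leadingZeros-nonzero L t Y = map-applyUpTo (λ i → i) (λ i → rotL^ (suc L + i) x) (period x)

  leadingZeros<period : L < period x
  leadingZeros<period with period x ≤? L | period-periodic x
  ... | no p≰L | _ = ≰⇒> p≰L
  ... | yes p≤L | 0<p , periodic = ⊥-elim (<⇒≢ (∸-monoʳ-< 0<p p≤L) (begin
    L ∸ p                                                ≡⟨ sym (leadingZeros-nonzero (L ∸ p) t (Y ++ zs p)) ⟩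
    leadingZeros (zs (L ∸ p) ++ suc t ∷ (Y ++ zs p))     ≡⟨ cong leadingZeros (sym rotated) ⟩
    leadingZeros (rotL^ p x)                             ≡⟨ cong leadingZeros periodic ⟩
    leadingZeros x                                       ≡⟨ leadingZeros-nonzero L t Y ⟩
    L                                                    ∎))
    where
    open ≡-Reasoning
    p = period x
    zs : ℕ → Word
    zs n = replicate n 0
    rotated : rotL^ p x ≡ zs (L ∸ p) ++ suc t ∷ (Y ++ zs p)
    rotated = begin
      rotL^ p x                                          ≡⟨ cong (λ m → rotL^ p (zs m ++ suc t ∷ Y)) (sym (m+[n∸m]≡n p≤L)) ⟩
      rotL^ p (zs (p + (L ∸ p)) ++ suc t ∷ Y)            ≡⟨ cong (λ w → rotL^ p (w ++ suc t ∷ Y)) (replicate-+ p (L ∸ p) 0) ⟩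
      rotL^ p ((zs p ++ zs (L ∸ p)) ++ suc t ∷ Y)        ≡⟨ cong (rotL^ p) (++-assoc (zs p) (zs (L ∸ p)) _) ⟩
      rotL^ p (zs p ++ zs (L ∸ p) ++ suc t ∷ Y)          ≡⟨ cong (λ m → rotL^ m (zs p ++ zs (L ∸ p) ++ suc t ∷ Y)) (sym (length-replicate p)) ⟩
      rotL^ (length (zs p)) (zs p ++ zs (L ∸ p) ++ suc t ∷ Y) ≡⟨ rotL^-++ (zs p) _ ⟩
      (zs (L ∸ p) ++ suc t ∷ Y) ++ zs p                  ≡⟨ ++-assoc (zs (L ∸ p)) (suc t ∷ Y) (zs p) ⟩
      zs (L ∸ p) ++ suc t ∷ (Y ++ zs p)                  ∎

  private
    p = period x
    d : ℕ
    d = proj₁ (m≤n⇒∃[o]m+o≡n leadingZeros<period)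
    1+L+d≡p : suc L + d ≡ p
    1+L+d≡p = proj₂ (m≤n⇒∃[o]m+o≡n leadingZeros<period)
    f : ℕ → Word
    f i = rotL^ (suc L + i) x

    f-index : ∀ {a} → a ≤ L → f (d + a) ≡ rotL^ a x
    f-index {a} _ = begin
      rotL^ (suc L + (d + a)) x   ≡⟨ cong (λ i → rotL^ i x) (sym (+-assoc (suc L) d a)) ⟩
      rotL^ (suc L + d + a) x     ≡⟨ cong (λ i → rotL^ (i + a) x) 1+L+d≡p ⟩
      rotL^ (p + a) x             ≡⟨ rotL^-periodic {p} (proj₂ (period-periodic x)) a ⟩
      rotL^ a x                   ∎
      where open ≡-Reasoning

    index<period : ∀ {a} → a ≤ L → d + a < p
    index<period {a} a≤L = begin-strict
      d + a        <⟨ +-monoʳ-< d (s≤s a≤L) ⟩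
      d + suc L    ≡⟨ +-comm d (suc L) ⟩
      suc L + d    ≡⟨ 1+L+d≡p ⟩
      p            ∎
      where open ≤-Reasoning

  rotL^-∈-cycle : ∀ {a} → a ≤ L → rotL^ a x ∈ cycle x
  rotL^-∈-cycle a≤L rewrite cycle-applyUpTo =
    subst (_∈ applyUpTo f p) (f-index a≤L) (∈-applyUpTo⁺ f (index<period a≤L))

  rotL^-precedes-in-cycle : ∀ {a b} → a < b → b ≤ L → Precedes (rotL^ a x) (rotL^ b x) (cycle x)
  rotL^-precedes-in-cycle {a} {b} a<b b≤L rewrite cycle-applyUpTo =
    subst₂ (λ u v → Precedes u v (applyUpTo f p)) (f-index (<⇒≤ (<-≤-trans a<b b≤L))) (f-index b≤L)
      (precedes-applyUpTo f (+-monoʳ-< d a<b) (index<period b≤L))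

rotL^-∈-cycle : ∀ {x a} → ¬ IsZero x → a ≤ leadingZeros x → rotL^ a x ∈ cycle x
rotL^-∈-cycle {x} {a} x≢0 a≤lz with zeroView x
... | zeros n = ⊥-elim (x≢0 (IsZero-replicate n))
... | nonzero L t Y = Cycle.rotL^-∈-cycle L t Y (subst (a ≤_) (leadingZeros-nonzero L t Y) a≤lz)

rotL^-precedes-in-cycle : ∀ {x a b} → ¬ IsZero x → a < b → b ≤ leadingZeros x →
  Precedes (rotL^ a x) (rotL^ b x) (cycle x)
rotL^-precedes-in-cycle {x} {a} {b} x≢0 a<b b≤lz with zeroView x
... | zeros n = ⊥-elim (x≢0 (IsZero-replicate n))
... | nonzero L t Y = Cycle.rotL^-precedes-in-cycle L t Y a<b (subst (b ≤_) (leadingZeros-nonzero L t Y) b≤lz)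

precedes-∈ʳ : ∀ {u v s} → Precedes u v s → v ∈ s
precedes-∈ʳ (here v∈s) = there v∈s
precedes-∈ʳ (there u≺v) = there (precedes-∈ʳ u≺v)

precedes-++⁺ˡ : ∀ {u v} p {s} → Precedes u v s → Precedes u v (p ++ s)
precedes-++⁺ˡ [] u≺v = u≺v
precedes-++⁺ˡ (_ ∷ p) u≺v = there (precedes-++⁺ˡ p u≺v)

precedes-++⁺ʳ : ∀ {u v c} s → Precedes u v c → Precedes u v (c ++ s)
precedes-++⁺ʳ s (here v∈c) = here (∈-++⁺ˡ v∈c)
precedes-++⁺ʳ s (there u≺v) = there (precedes-++⁺ʳ s u≺v)

precedes-++ : ∀ {u v c s} → u ∈ c → v ∈ s → Precedes u v (c ++ s)
precedes-++ {c = _ ∷ c} (here refl) v∈s = here (∈-++⁺ʳ c v∈s)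
precedes-++ (there u∈c) v∈s = there (precedes-++ u∈c v∈s)

precedes⇒Before : ∀ {u v s} → Precedes u v s → Before s u v
precedes⇒Before (here v∈s) with ys , zs , refl ← ∈-∃++ v∈s = [] , ys , zs , refl
precedes⇒Before {s = x ∷ _} (there u≺v) with xs , ys , zs , refl ← precedes⇒Before u≺v = x ∷ xs , ys , zs , refl

module _ (t : Word) (c : List Word) where

  ∈-insertAfter⁺ : ∀ {x s} → x ∈ s → x ∈ insertAfter t c s
  ∈-insertAfter⁺ {s = y ∷ s} x∈s with ≡-dec _≟_ y t | x∈s
  ... | yes _ | here x≡y = here x≡y
  ... | yes _ | there x∈s′ = there (∈-++⁺ʳ c x∈s′)
  ... | no _ | here x≡y = here x≡y
  ... | no _ | there x∈s′ = there (∈-insertAfter⁺ x∈s′)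

  ∈-insertAfter⁺-inserted : ∀ {u s} → t ∈ s → u ∈ c → u ∈ insertAfter t c s
  ∈-insertAfter⁺-inserted {s = y ∷ s} t∈s u∈c with ≡-dec _≟_ y t | t∈s
  ... | yes _ | _ = there (∈-++⁺ˡ u∈c)
  ... | no y≢t | here t≡y = ⊥-elim (y≢t (sym t≡y))
  ... | no _ | there t∈s′ = there (∈-insertAfter⁺-inserted t∈s′ u∈c)

  precedes-insertAfter : ∀ {u v s} → Precedes u v s → Precedes u v (insertAfter t c s)
  precedes-insertAfter {s = y ∷ s} u≺v with ≡-dec _≟_ y t | u≺v
  ... | yes _ | here v∈s = here (∈-++⁺ʳ c v∈s)
  ... | yes _ | there u≺v′ = there (precedes-++⁺ˡ c u≺v′)
  ... | no _ | here v∈s = here (∈-insertAfter⁺ v∈s)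
  ... | no _ | there u≺v′ = there (precedes-insertAfter u≺v′)

  precedes-insertAfter-inserted : ∀ {u v s} → t ∈ s → Precedes u v c → Precedes u v (insertAfter t c s)
  precedes-insertAfter-inserted {s = y ∷ s} t∈s u≺v with ≡-dec _≟_ y t | t∈s
  ... | yes _ | _ = there (precedes-++⁺ʳ s u≺v)
  ... | no y≢t | here t≡y = ⊥-elim (y≢t (sym t≡y))
  ... | no _ | there t∈s′ = there (precedes-insertAfter-inserted t∈s′ u≺v)

  precedes-insertAfter-target : ∀ {u v s} → Precedes t v s → u ∈ c → Precedes u v (insertAfter t c s)
  precedes-insertAfter-target {s = y ∷ s} t≺v u∈c with ≡-dec _≟_ y t | t≺v
  ... | yes _ | here v∈s = there (precedes-++ u∈c v∈s)
  ... | yes _ | there t≺v′ = there (precedes-++ u∈c (precedes-∈ʳ t≺v′))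
  ... | no y≢t | here _ = ⊥-elim (y≢t refl)
  ... | no _ | there t≺v′ = there (precedes-insertAfter-target t≺v′ u∈c)

-- Key-words are handled through their reversals, which are lexicographically maximal among their rotations.
RotationMaximal : Word → Set
RotationMaximal R = ∀ A B → R ≡ A ++ B → B ++ A ≼ R

take-length-++ : ∀ {X : Set} (A B : List X) → take (length A) (A ++ B) ≡ A
take-length-++ [] B = refl
take-length-++ (x ∷ A) B = cong (x ∷_) (take-length-++ A B)

drop-length-++ : ∀ {X : Set} (A B : List X) → drop (length A) (A ++ B) ≡ B
drop-length-++ [] B = refl
drop-length-++ (_ ∷ A) B = drop-length-++ A B

reverse-++-reverse : ∀ (A B : Word) → reverse (reverse A ++ reverse B) ≡ B ++ A
reverse-++-reverse A B = trans (reverse-++ (reverse A) (reverse B))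
  (cong₂ _++_ (reverse-involutive B) (reverse-involutive A))

T-∧-All : ∀ {f : Word → Bool} {h : List Word → Bool} → h [] ≡ true → (∀ r rs → h (r ∷ rs) ≡ (f r ∧ h rs)) →
  ∀ rs → T (h rs) ⇔ All (T ∘ f) rs
T-∧-All h[] h∷ [] = mk⇔ (λ _ → []) (λ _ → subst T (sym h[]) _)
T-∧-All {f} {h} h[] h∷ (r ∷ rs) = mk⇔
  (λ hrs → let fr , hrs′ = Equivalence.to T-∧ (subst T (h∷ r rs) hrs) in fr ∷ Equivalence.to (T-∧-All h[] h∷ rs) hrs′)
  (λ { (fr ∷ all) → subst T (sym (h∷ r rs)) (Equivalence.from T-∧ (fr , Equivalence.from (T-∧-All h[] h∷ rs) all)) })

IsKeyWord⇔All : ∀ w → IsKeyWord w ⇔ All (_≼ᶜ w) (rotations w)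
IsKeyWord⇔All w with T-∧-All refl (λ _ _ → refl) | rotations w
... | spec | rs = spec rs

rotation-∈-rotations : ∀ (X Y : Word) → 0 < length Y → Y ++ X ∈ rotations (X ++ Y)
rotation-∈-rotations X Y 0<|Y| = subst (_∈ rotations (X ++ Y))
  (cong₂ _++_ (drop-length-++ X Y) (take-length-++ X Y))
  (∈-map⁺ (λ i → drop i (X ++ Y) ++ take i (X ++ Y)) (∈-upTo⁺ |X|<|X++Y|))
  where
  |X|<|X++Y| : length X < length (X ++ Y)
  |X|<|X++Y| = subst (length X <_) (sym (length-++ X)) (m<m+n (length X) 0<|Y|)

IsKeyWord⇒RotationMaximal : ∀ w → IsKeyWord w → RotationMaximal (reverse w)
IsKeyWord⇒RotationMaximal w key [] B rw≡B =
  subst (λ v → B ++ [] ≼ v) (sym rw≡B) (subst (_≼ B) (sym (++-identityʳ B)) (≼-refl B))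
IsKeyWord⇒RotationMaximal w key A@(_ ∷ _) B rw≡AB = subst (_≼ reverse w) (reverse-++-reverse A B)
  (lookup (Equivalence.to (IsKeyWord⇔All w) key)
    (subst (λ v → reverse A ++ reverse B ∈ rotations v) (sym w≡) (rotation-∈-rotations (reverse B) (reverse A) 0<|A|)))
  where
  w≡ : w ≡ reverse B ++ reverse A
  w≡ = trans (sym (reverse-involutive w)) (trans (cong reverse rw≡AB) (reverse-++ A B))
  0<|A| : 0 < length (reverse A)
  0<|A| = subst (0 <_) (sym (length-reverse A)) (s≤s z≤n)

RotationMaximal⇒IsKeyWord : ∀ w → RotationMaximal (reverse w) → IsKeyWord w
RotationMaximal⇒IsKeyWord w max = Equivalence.from (IsKeyWord⇔All w) (tabulate rotation-≼ᶜ)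
  where
  rotation-≼ᶜ : ∀ {r} → r ∈ rotations w → r ≼ᶜ w
  rotation-≼ᶜ r∈ with i , _ , refl ← ∈-map⁻ (λ i → drop i w ++ take i w) r∈ =
    subst (_≼ reverse w) (sym (reverse-++ (drop i w) (take i w)))
      (max (reverse (drop i w)) (reverse (take i w))
        (trans (cong reverse (sym (take++drop≡id i w))) (reverse-++ (take i w) (drop i w))))

++-split : ∀ (A B P C : Word) → A ++ B ≡ P ++ C →
  (∃[ M ] P ≡ A ++ M × B ≡ M ++ C) ⊎ (∃₂ λ m M → A ≡ P ++ m ∷ M × C ≡ m ∷ M ++ B)
++-split [] B P C AB≡PC = inj₁ (P , refl , AB≡PC)
++-split (a ∷ A) B [] C AB≡PC = inj₂ (a , A , refl , sym AB≡PC)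
++-split (a ∷ A) B (p ∷ P) C AB≡PC with refl ← ∷-injectiveˡ AB≡PC | ++-split A B P C (∷-injectiveʳ AB≡PC)
... | inj₁ (M , P≡AM , B≡MC) = inj₁ (M , cong (a ∷_) P≡AM , B≡MC)
... | inj₂ (m , M , A≡PmM , C≡mMB) = inj₂ (m , M , cong (a ∷_) A≡PmM , C≡mMB)

split-at-length : ∀ (M X : Word) → length M < length X →
  ∃₂ λ Q q → ∃[ Q′ ] X ≡ Q ++ q ∷ Q′ × length Q ≡ length M
split-at-length [] (x ∷ X) _ = [] , x , X , refl , refl
split-at-length (_ ∷ M) (x ∷ X) (s≤s |M|<|X|) with Q , q , Q′ , X≡ , |Q|≡|M| ← split-at-length M X |M|<|X| =
  x ∷ Q , q , Q′ , cong (x ∷_) X≡ , cong suc |Q|≡|M|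

≼-decrease-at : ∀ (M Q : Word) {t q} (X X′ Y Y′ : Word) → length M ≡ length Q →
  M ++ suc t ∷ X ≼ Q ++ q ∷ Y → M ++ t ∷ X′ ≼ Q ++ q ∷ Y′
≼-decrease-at M Q {t} {q} X X′ Y Y′ |M|≡|Q| u≼v with ≡-dec _≟_ M Q
... | yes refl = subst T (sym (lexLeq-++ M _ _))
                   (≼-< X′ Y′ (≼-head {suc t} {q} {X} {Y} (subst T (lexLeq-++ M _ _) u≼v)))
... | no M≢Q = subst T (lexLeq-distinct-prefix M Q _ _ _ _ |M|≡|Q| M≢Q) u≼v

IsZero-≡ : ∀ {x y} → IsZero x → IsZero y → length x ≡ length y → x ≡ y
IsZero-≡ x≡0 y≡0 |x|≡|y| = trans (IsZero⇒replicate x≡0 |x|≡|y|) (sym (IsZero⇒replicate y≡0 refl))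

decrement-rotation-inside : ∀ A M t Z → RotationMaximal ((A ++ M) ++ suc t ∷ Z) →
  (M ++ t ∷ Z) ++ A ≼ (A ++ M) ++ t ∷ Z
decrement-rotation-inside [] M t Z _ = subst (_≼ M ++ t ∷ Z) (sym (++-identityʳ (M ++ t ∷ Z))) (≼-refl (M ++ t ∷ Z))
decrement-rotation-inside A@(_ ∷ A′) M t Z max
  with Q , q , Q′ , AM≡ , |Q|≡|M| ← split-at-length M (A ++ M) (s≤s (length-++-≤ʳ M {A′}))
  = subst₂ _≼_ (sym (++-assoc M (t ∷ Z) A)) (trans (sym (++-assoc Q (q ∷ Q′) (t ∷ Z))) (cong (_++ t ∷ Z) (sym AM≡)))
      (≼-decrease-at M Q (Z ++ A) (Z ++ A) (Q′ ++ suc t ∷ Z) (Q′ ++ t ∷ Z) (sym |Q|≡|M|)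
        (subst₂ _≼_ (++-assoc M (suc t ∷ Z) A) (trans (cong (_++ suc t ∷ Z) AM≡) (++-assoc Q (q ∷ Q′) (suc t ∷ Z)))
          (max A (M ++ suc t ∷ Z) (++-assoc A M (suc t ∷ Z)))))

decrement-rotation-through-zeros : ∀ P t M B → IsZero (M ++ B) → RotationMaximal (P ++ suc t ∷ (M ++ B)) →
  B ++ P ++ t ∷ M ≼ P ++ t ∷ (M ++ B)
decrement-rotation-through-zeros P t M [] _ _ =
  subst (λ v → P ++ t ∷ M ≼ P ++ t ∷ v) (sym (++-identityʳ M)) (≼-refl (P ++ t ∷ M))
decrement-rotation-through-zeros (p ∷ P) t M (b ∷ B) MB≡0 max with refl ∷ _ ← ++⁻ʳ M MB≡0 =
  ≼-< (B ++ p ∷ P ++ t ∷ M) (P ++ t ∷ M ++ 0 ∷ B) (<-≤-trans z<s (≼-head {suc t} {p} {(M ++ 0 ∷ B) ++ p ∷ P} {P ++ suc t ∷ M ++ 0 ∷ B} (max (p ∷ P) (suc t ∷ M ++ 0 ∷ B) refl)))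
decrement-rotation-through-zeros [] (suc t) M (b ∷ B) MB≡0 _ with refl ∷ _ ← ++⁻ʳ M MB≡0 =
  ≼-< (B ++ suc t ∷ M) (M ++ 0 ∷ B) (z<s {t})
decrement-rotation-through-zeros [] zero M (b ∷ B) MB≡0 _ with refl ∷ B≡0 ← ++⁻ʳ M MB≡0 =
  subst (0 ∷ B ++ 0 ∷ M ≼_)
    (IsZero-≡ (++⁺ (refl ∷ B≡0) (refl ∷ ++⁻ˡ M MB≡0)) (refl ∷ MB≡0) (length-++-comm (0 ∷ B) (0 ∷ M)))
    (≼-refl (0 ∷ B ++ 0 ∷ M))

-- A rotation either cuts inside P, and then the decreased letter is compared with the same letter as
-- before and is now strictly smaller (unless the comparison was already decided earlier), or it only
-- moves some of the trailing zeros to the front.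
RotationMaximal-decrement : ∀ P t a → RotationMaximal (P ++ suc t ∷ replicate a 0) →
  RotationMaximal (P ++ t ∷ replicate a 0)
RotationMaximal-decrement P t a max A B PtZ≡AB with ++-split A B P (t ∷ Z) (sym PtZ≡AB)
  where Z = replicate a 0
... | inj₁ (M , refl , refl) = decrement-rotation-inside A M t (replicate a 0) max
... | inj₂ (m , M , refl , tZ≡mMB) with refl ← ∷-injectiveˡ tZ≡mMB =
  subst (λ Z → B ++ P ++ t ∷ M ≼ P ++ t ∷ Z) (sym Z≡MB)
    (decrement-rotation-through-zeros P t M B (subst IsZero Z≡MB (IsZero-replicate a))
      (subst (λ Z → RotationMaximal (P ++ suc t ∷ Z)) Z≡MB max))
  where
  Z≡MB : replicate a 0 ≡ M ++ B
  Z≡MB = ∷-injectiveʳ tZ≡mMB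

replicate-∷ʳ : ∀ m (x : ℕ) → replicate m x ∷ʳ x ≡ replicate (suc m) x
replicate-∷ʳ m x = trans (sym (replicate-+ m 1 x)) (cong (λ i → replicate i x) (+-comm m 1))

reverse-replicate : ∀ n (x : ℕ) → reverse (replicate n x) ≡ replicate n x
reverse-replicate zero x = refl
reverse-replicate (suc n) x = begin
  reverse (x ∷ replicate n x)      ≡⟨ unfold-reverse x (replicate n x) ⟩
  reverse (replicate n x) ∷ʳ x     ≡⟨ cong (_∷ʳ x) (reverse-replicate n x) ⟩
  replicate n x ∷ʳ x               ≡⟨ replicate-∷ʳ n x ⟩
  replicate (suc n) x              ∎
  where open ≡-Reasoning

reverse-nonzero : ∀ a s Y → reverse (replicate a 0 ++ s ∷ Y) ≡ reverse Y ++ s ∷ replicate a 0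
reverse-nonzero a s Y = begin
  reverse (replicate a 0 ++ s ∷ Y)                  ≡⟨ reverse-++ (replicate a 0) (s ∷ Y) ⟩
  reverse (s ∷ Y) ++ reverse (replicate a 0)        ≡⟨ cong₂ _++_ (unfold-reverse s Y) (reverse-replicate a 0) ⟩
  (reverse Y ∷ʳ s) ++ replicate a 0                 ≡⟨ ++-assoc (reverse Y) (s ∷ []) (replicate a 0) ⟩
  reverse Y ++ s ∷ replicate a 0                    ∎
  where open ≡-Reasoning

All-reverse⁺ : ∀ {P : ℕ → Set} {xs} → All P xs → All P (reverse xs)
All-reverse⁺ pxs = All.tabulate (lookup pxs ∘ Any.reverse⁻)

All-reverse⁻ : ∀ {P : ℕ → Set} {xs} → All P (reverse xs) → All P xs
All-reverse⁻ pxs = All.tabulate (lookup pxs ∘ Any.reverse⁺)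

IsKeyWord-decrement : ∀ a t Y → IsKeyWord (replicate a 0 ++ suc t ∷ Y) → IsKeyWord (replicate a 0 ++ t ∷ Y)
IsKeyWord-decrement a t Y key = RotationMaximal⇒IsKeyWord (replicate a 0 ++ t ∷ Y)
  (subst RotationMaximal (sym (reverse-nonzero a t Y))
    (RotationMaximal-decrement (reverse Y) t a
      (subst RotationMaximal (reverse-nonzero a (suc t) Y) (IsKeyWord⇒RotationMaximal (replicate a 0 ++ suc t ∷ Y) key))))

decrement-≼ᶜ : ∀ a t Y → replicate a 0 ++ t ∷ Y ≼ᶜ replicate a 0 ++ suc t ∷ Y
decrement-≼ᶜ a t Y = subst₂ _≼_ (sym (reverse-nonzero a t Y)) (sym (reverse-nonzero a (suc t) Y))
  (subst T (sym (lexLeq-++ (reverse Y) _ _)) (≼-< (replicate a 0) (replicate a 0) (n<1+n t)))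

decrement-≢ : ∀ a t Y → replicate a 0 ++ t ∷ Y ≢ replicate a 0 ++ suc t ∷ Y
decrement-≢ a t Y eq = 1+n≢n (sym (∷-injectiveˡ (++-cancelˡ (replicate a 0) (t ∷ Y) (suc t ∷ Y) eq)))

IsKeyWord-zeros : ∀ n → IsKeyWord (replicate n 0)
IsKeyWord-zeros n = RotationMaximal⇒IsKeyWord (replicate n 0) (subst RotationMaximal (sym (reverse-replicate n 0)) max)
  where
  max : RotationMaximal (replicate n 0)
  max A B Z≡AB = subst (B ++ A ≼_) (IsZero-≡ (++⁺ (++⁻ʳ A AB≡0) (++⁻ˡ A AB≡0)) (IsZero-replicate n) |BA|≡n) (≼-refl (B ++ A))
    where
    AB≡0 : IsZero (A ++ B)
    AB≡0 = subst IsZero Z≡AB (IsZero-replicate n)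
    |BA|≡n : length (B ++ A) ≡ length (replicate n 0)
    |BA|≡n = trans (length-++-comm B A) (cong length (sym Z≡AB))

RotationMaximal-zeros-++ : ∀ r V → RotationMaximal (replicate (suc r) 0 ++ V) → IsZero V
RotationMaximal-zeros-++ r V max with zeroView V
... | zeros b = IsZero-replicate b
... | nonzero b c X = ⊥-elim (n≮0 (≼-head {suc c} {0} {X ++ Z} {replicate r 0 ++ suc c ∷ X}
        (subst T (lexLeq-++ (replicate b 0) _ _) (subst₂ _≼_ rotated shifted (max Z (replicate b 0 ++ suc c ∷ X) refl)))))
  where
  Z = replicate (suc r) 0
  rotated : (replicate b 0 ++ suc c ∷ X) ++ Z ≡ replicate b 0 ++ suc c ∷ X ++ Z
  rotated = ++-assoc (replicate b 0) (suc c ∷ X) Z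
  shifted : Z ++ replicate b 0 ++ suc c ∷ X ≡ replicate b 0 ++ Z ++ suc c ∷ X
  shifted = begin
    Z ++ replicate b 0 ++ suc c ∷ X              ≡⟨ sym (++-assoc Z (replicate b 0) _) ⟩
    (Z ++ replicate b 0) ++ suc c ∷ X            ≡⟨ cong (_++ suc c ∷ X) (sym (replicate-+ (suc r) b 0)) ⟩
    replicate (suc r + b) 0 ++ suc c ∷ X         ≡⟨ cong (λ m → replicate m 0 ++ suc c ∷ X) (+-comm (suc r) b) ⟩
    replicate (b + suc r) 0 ++ suc c ∷ X         ≡⟨ cong (_++ suc c ∷ X) (replicate-+ b (suc r) 0) ⟩
    (replicate b 0 ++ Z) ++ suc c ∷ X            ≡⟨ ++-assoc (replicate b 0) Z _ ⟩
    replicate b 0 ++ Z ++ suc c ∷ X              ∎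
    where open ≡-Reasoning

IsKeyWord-zero-suffix : ∀ z y R → IsKeyWord (z ++ y ∷ R) → IsZero (y ∷ R) → IsZero z
IsKeyWord-zero-suffix z y R key yR≡0 = All-reverse⁻ (RotationMaximal-zeros-++ (length R) (reverse z)
  (subst RotationMaximal reversed (IsKeyWord⇒RotationMaximal (z ++ y ∷ R) key)))
  where
  reversed : reverse (z ++ y ∷ R) ≡ replicate (suc (length R)) 0 ++ reverse z
  reversed = trans (reverse-++ z (y ∷ R))
    (cong (_++ reverse z) (trans (cong reverse (IsZero⇒replicate yR≡0 refl)) (reverse-replicate _ 0)))

infix 4 _≺_

_≺_ : Word → Word → Set
x ≺ y = ¬ (y ≼ x)

lexWords-sorted : ∀ n k → AllPairs _≺_ (lexWords n k)
lexWords-sorted zero k = [] ∷ []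
lexWords-sorted (suc n) k = AllPairs.concat⁺
  (All.map⁺ (All.universal (λ a → AllPairs.map⁺ (AllPairs.map (∷-≺ a) (lexWords-sorted n k))) (upTo k)))
  (AllPairs.map⁺ (AllPairs.applyUpTo⁺₁ id k (λ i<j _ → All.map⁺ (All.universal (λ x →
    All.map⁺ (All.universal (λ y → ≺-head x y i<j) _)) _))))
  where
  ∷-≺ : ∀ a {x y} → x ≺ y → a ∷ x ≺ a ∷ y
  ∷-≺ a {x} {y} x≺y ax≽ay = x≺y (subst T (lexLeq-∷ a y x) ax≽ay)
  ≺-head : ∀ {i j} x y → i < j → i ∷ x ≺ j ∷ y
  ≺-head {i} {j} x y i<j jy≼ix = <⇒≱ i<j (≼-head {j} {i} {y} {x} jy≼ix)

infix 4 _≺ᶜ_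

_≺ᶜ_ : Word → Word → Set
x ≺ᶜ y = ¬ (y ≼ᶜ x)

keys-sorted : ∀ n k → AllPairs _≺ᶜ_ (keys n k)
keys-sorted n k = AllPairs.filter⁺ (λ w → T? (isKey w)) (AllPairs.map⁺
  (AllPairs.map {S = λ x y → reverse x ≺ᶜ reverse y} (λ {x} {y} → reverse-≺ {x} {y}) (lexWords-sorted n k)))
  where
  reverse-≺ : ∀ {x y} → x ≺ y → reverse x ≺ᶜ reverse y
  reverse-≺ {x} {y} x≺y = x≺y ∘ subst₂ _≼_ (reverse-involutive y) (reverse-involutive x)

∈-lexWords⁺ : ∀ {k} w → All (_< k) w → w ∈ lexWords (length w) k
∈-lexWords⁺ [] [] = here refl
∈-lexWords⁺ {k} (x ∷ w) (x<k ∷ w<k) = ∈-concatMap⁺ (λ a → map (a ∷_) (lexWords (length w) k))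
  (Any.map (λ { refl → ∈-map⁺ (x ∷_) (∈-lexWords⁺ w w<k) }) (∈-upTo⁺ x<k))

∈-lexWords⁻ : ∀ {n k w} → w ∈ lexWords n k → length w ≡ n × All (_< k) w
∈-lexWords⁻ {zero} (here refl) = refl , []
∈-lexWords⁻ {suc n} {k} w∈ with a , a∈ , aw∈ ← find (∈-concatMap⁻ (λ a → map (a ∷_) (lexWords n k)) {xs = upTo k} w∈)
  with v , v∈ , refl ← ∈-map⁻ (a ∷_) aw∈
  with |v|≡n , v<k ← ∈-lexWords⁻ v∈ = cong suc |v|≡n , ∈-upTo⁻ a∈ ∷ v<k

∈-keys⁺ : ∀ {n k} w → length w ≡ n → All (_< k) w → IsKeyWord w → w ∈ keys n k
∈-keys⁺ {n} {k} w refl w<k key = ∈-filter⁺ (λ w → T? (isKey w))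
  (subst (_∈ colexWords n k) (reverse-involutive w)
    (∈-map⁺ reverse (subst (λ m → reverse w ∈ lexWords m k) (length-reverse w) (∈-lexWords⁺ (reverse w) (All-reverse⁺ w<k)))))
  key

∈-keys⁻ : ∀ {n k w} → w ∈ keys n k → length w ≡ n × All (_< k) w × IsKeyWord w
∈-keys⁻ {n} {k} w∈ with w∈colex , key ← ∈-filter⁻ (λ w → T? (isKey w)) {xs = colexWords n k} w∈
  with v , v∈ , refl ← ∈-map⁻ reverse w∈colex
  with |v|≡n , v<k ← ∈-lexWords⁻ v∈ = trans (length-reverse v) |v|≡n , All-reverse⁺ v<k , key

drop-replicate-++ : ∀ a (X : Word) → drop a (replicate a 0 ++ X) ≡ X
drop-replicate-++ zero X = refl
drop-replicate-++ (suc a) X = drop-replicate-++ a X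

target-nonzero : ∀ a t Y → target (replicate a 0 ++ suc t ∷ Y) ≡ t ∷ Y ++ replicate a 0
target-nonzero a t Y rewrite leadingZeros-nonzero a t Y | drop-replicate-++ a (suc t ∷ Y) =
  cong (λ m → t ∷ Y ++ replicate m 0) (leadingZeros-nonzero a t Y)

target-rotL^ : ∀ a t Y → target (replicate a 0 ++ suc t ∷ Y) ≡ rotL^ a (replicate a 0 ++ t ∷ Y)
target-rotL^ a t Y = begin
  target (replicate a 0 ++ suc t ∷ Y)                                ≡⟨ target-nonzero a t Y ⟩
  t ∷ Y ++ replicate a 0                                             ≡⟨ rotL^-++ (replicate a 0) (t ∷ Y) ⟨
  rotL^ (length (replicate a 0)) (replicate a 0 ++ t ∷ Y)            ≡⟨ cong (λ m → rotL^ m (replicate a 0 ++ t ∷ Y)) (length-replicate a) ⟩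
  rotL^ a (replicate a 0 ++ t ∷ Y)                                   ∎
  where open ≡-Reasoning

rotL^-replicate : ∀ j m (x : ℕ) → rotL^ j (replicate m x) ≡ replicate m x
rotL^-replicate zero m x = refl
rotL^-replicate (suc j) zero x = cong rotL (rotL^-replicate j zero x)
rotL^-replicate (suc j) (suc m) x = trans (cong rotL (rotL^-replicate j (suc m) x)) (replicate-∷ʳ m x)

lexWords-head : ∀ n k → ∃[ r ] lexWords n (suc k) ≡ replicate n 0 ∷ r
lexWords-head zero k = [] , refl
lexWords-head (suc n) k with r , eq ← lexWords-head n k =
  _ , cong (λ L → concatMap (λ a → map (a ∷_) L) (upTo (suc k))) eq

keys-head : ∀ n k → keys n (suc k) ≡ replicate n 0 ∷ drop 1 (keys n (suc k))
keys-head n k = trans keys≡ (cong (replicate n 0 ∷_) (sym (cong (drop 1) keys≡)))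
  where
  r = proj₁ (lexWords-head n k)
  keys≡ : keys n (suc k) ≡ replicate n 0 ∷ filter (λ w → T? (isKey w)) (map reverse r)
  keys≡ = begin
    keys n (suc k)                                                        ≡⟨ cong (filter (λ w → T? (isKey w)) ∘ map reverse) (proj₂ (lexWords-head n k)) ⟩
    filter (λ w → T? (isKey w)) (reverse (replicate n 0) ∷ map reverse r) ≡⟨ cong (λ w → filter (λ w → T? (isKey w)) (w ∷ map reverse r)) (reverse-replicate n 0) ⟩
    filter (λ w → T? (isKey w)) (replicate n 0 ∷ map reverse r)           ≡⟨ filter-accept (λ w → T? (isKey w)) (IsKeyWord-zeros n) ⟩
    replicate n 0 ∷ filter (λ w → T? (isKey w)) (map reverse r)           ∎
    where open ≡-Reasoning

insertCycle : List Word → Word → List Word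
insertCycle s key = insertAfter (target key) (cycle key) s

construct : ℕ → List Word → List Word
construct n = foldl insertCycle (replicate n 0 ∷ [])

construct-∷ʳ : ∀ n Ks K → construct n (Ks ∷ʳ K) ≡ insertCycle (construct n Ks) K
construct-∷ʳ n Ks K = foldl-∷ʳ insertCycle (replicate n 0 ∷ []) K Ks

precedes-construct-++ : ∀ {u v} n Ks Ls → Precedes u v (construct n Ks) → Precedes u v (construct n (Ks ++ Ls))
precedes-construct-++ n Ks Ls u≺v = subst (Precedes _ _) (sym (foldl-++ insertCycle _ Ks Ls)) (go Ls u≺v)
  where
  go : ∀ {u v s} Ls → Precedes u v s → Precedes u v (foldl insertCycle s Ls)
  go [] u≺v = u≺v
  go (K ∷ Ls) u≺v = go Ls (precedes-insertAfter (target K) (cycle K) u≺v)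

precedes-construct-∷ʳ : ∀ {u v} n Ks K → Precedes (target K) v (construct n Ks) → u ∈ cycle K →
  Precedes u v (construct n (Ks ∷ʳ K))
precedes-construct-∷ʳ n Ks K t≺v u∈ rewrite construct-∷ʳ n Ks K =
  precedes-insertAfter-target (target K) (cycle K) t≺v u∈

zeros-∈-construct : ∀ n Ks → replicate n 0 ∈ construct n Ks
zeros-∈-construct n Ks = go Ks (here refl)
  where
  go : ∀ {s} Ks → replicate n 0 ∈ s → replicate n 0 ∈ foldl insertCycle s Ks
  go [] z∈s = z∈s
  go (K ∷ Ks) z∈s = go Ks (∈-insertAfter⁺ (target K) (cycle K) z∈s)

sum-zeros-++ : ∀ a X → sum (replicate a 0 ++ X) ≡ sum X
sum-zeros-++ zero X = refl
sum-zeros-++ (suc a) X = sum-zeros-++ a X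

leadingZeros<length : ∀ a t Y → a < length (replicate a 0 ++ suc t ∷ Y)
leadingZeros<length zero t Y = z<s
leadingZeros<length (suc a) t Y = s≤s (leadingZeros<length a t Y)

length-decrement : ∀ (A : Word) s t Y → length (A ++ s ∷ Y) ≡ length (A ++ t ∷ Y)
length-decrement [] s t Y = refl
length-decrement (_ ∷ A) s t Y = cong suc (length-decrement A s t Y)

All<-decrement : ∀ {k} a t Y → All (_< k) (replicate a 0 ++ suc t ∷ Y) → All (_< k) (replicate a 0 ++ t ∷ Y)
All<-decrement a t Y all with st<k ∷ Y<k ← ++⁻ʳ (replicate a 0) all =
  ++⁺ (++⁻ˡ (replicate a 0) all) (<⇒≤ st<k ∷ Y<k)

-- Keys⁺ lists key_1, key_2, … ; D n (suc k) is construct n Keys⁺ by definition.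
module KeyList (n k : ℕ) where

  Keys⁺ : List Word
  Keys⁺ = drop 1 (keys n (suc k))

  private
    sorted : AllPairs _≺ᶜ_ (replicate n 0 ∷ Keys⁺)
    sorted = subst (AllPairs _≺ᶜ_) (keys-head n k) (keys-sorted n (suc k))

  ∈-Keys⁺⁻ : ∀ {K} → K ∈ Keys⁺ → length K ≡ n × All (_< suc k) K × IsKeyWord K × ¬ IsZero K
  ∈-Keys⁺⁻ {K} K∈ with |K|≡n , K<k , key ← ∈-keys⁻ (subst (K ∈_) (sym (keys-head n k)) (there K∈)) =
    |K|≡n , K<k , key , K≢0
    where
    K≢0 : ¬ IsZero K
    K≢0 K≡0 with zeros≺K ∷ _ ← sorted =
      lookup zeros≺K K∈ (subst (K ≼ᶜ_) (IsZero⇒replicate K≡0 |K|≡n) (≼-refl (reverse K)))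

  ∈-Keys⁺⁺ : ∀ {K} → length K ≡ n → All (_< suc k) K → IsKeyWord K → ¬ IsZero K → K ∈ Keys⁺
  ∈-Keys⁺⁺ {K} |K|≡n K<k key K≢0 with subst (K ∈_) (keys-head n k) (∈-keys⁺ K |K|≡n K<k key)
  ... | here refl = ⊥-elim (K≢0 (IsZero-replicate n))
  ... | there K∈ = K∈

  Keys⁺-earlier : ∀ {pre K post K′} → Keys⁺ ≡ pre ++ K ∷ post → K′ ∈ Keys⁺ → K′ ≼ᶜ K → K′ ≢ K → K′ ∈ pre
  Keys⁺-earlier {pre} {K} {post} Keys⁺≡ K′∈ K′≼K K′≢K with ∈-++⁻ pre (subst (_ ∈_) Keys⁺≡ K′∈)
  ... | inj₁ K′∈pre = K′∈pre
  ... | inj₂ (here K′≡K) = ⊥-elim (K′≢K K′≡K)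
  ... | inj₂ (there K′∈post) with _ ∷ sorted′ ← sorted
    with K≺post ∷ _ ← subst (AllPairs _≺ᶜ_) (trans (cong (drop (length pre)) Keys⁺≡) (drop-length-++ pre (K ∷ post)))
                        (AllPairs.drop⁺ (length pre) sorted′)
    = ⊥-elim (lookup K≺post K′∈post K′≼K)

  decrement-earlier : ∀ {pre post} a t Y → Keys⁺ ≡ pre ++ (replicate a 0 ++ suc t ∷ Y) ∷ post →
    IsZero (replicate a 0 ++ t ∷ Y) ⊎ (¬ IsZero (replicate a 0 ++ t ∷ Y) × replicate a 0 ++ t ∷ Y ∈ pre)
  decrement-earlier {pre} a t Y Keys⁺≡ with All.all? (_≟ 0) (replicate a 0 ++ t ∷ Y)
  ... | yes K′≡0 = inj₁ K′≡0
  ... | no K′≢0 with |K|≡n , K<k , key , _ ← ∈-Keys⁺⁻ (subst (_ ∈_) (sym Keys⁺≡) (∈-++⁺ʳ pre (here refl))) =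
    inj₂ (K′≢0 , Keys⁺-earlier Keys⁺≡
      (∈-Keys⁺⁺ (trans (length-decrement (replicate a 0) t (suc t) Y) |K|≡n) (All<-decrement a t Y K<k)
        (IsKeyWord-decrement a t Y key) K′≢0)
      (decrement-≼ᶜ a t Y) (decrement-≢ a t Y))

  CyclesPresent : List Word → Set
  CyclesPresent pre = ∀ {K u} → K ∈ pre → u ∈ cycle K → u ∈ construct n pre

  target-∈-construct : ∀ {pre K post} → Keys⁺ ≡ pre ++ K ∷ post → CyclesPresent pre → target K ∈ construct n pre
  target-∈-construct {pre} {K} Keys⁺≡ present
    with |K|≡n , _ , _ , K≢0 ← ∈-Keys⁺⁻ (subst (K ∈_) (sym Keys⁺≡) (∈-++⁺ʳ pre (here refl)))
    with zeroView K
  ... | zeros m = ⊥-elim (K≢0 (IsZero-replicate m))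
  ... | nonzero a t Y rewrite target-rotL^ a t Y with decrement-earlier a t Y Keys⁺≡
  ...   | inj₂ (K′≢0 , K′∈pre) = present K′∈pre (rotL^-∈-cycle K′≢0 (leadingZeros-replicate-++ a (t ∷ Y)))
  ...   | inj₁ K′≡0 = subst (_∈ construct n pre) (sym K′-rotation≡zeros) (zeros-∈-construct n pre)
    where
    K′-rotation≡zeros : rotL^ a (replicate a 0 ++ t ∷ Y) ≡ replicate n 0
    K′-rotation≡zeros = trans
      (cong (rotL^ a) (IsZero⇒replicate K′≡0 (trans (length-decrement (replicate a 0) t (suc t) Y) |K|≡n)))
      (rotL^-replicate a n 0)

  cycles-present : ∀ {pre post} → Keys⁺ ≡ pre ++ post → CyclesPresent pre
  cycles-present {pre} = go (reverseView pre)
    where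
    go : ∀ {pre post} → Reverse pre → Keys⁺ ≡ pre ++ post → CyclesPresent pre
    go [] _ ()
    go {post = post} (ys ∶ rs ∶ʳ y) Keys⁺≡ {K} K∈ u∈ rewrite construct-∷ʳ n ys y
      with ∈-++⁻ ys K∈ | trans Keys⁺≡ (++-assoc ys (y ∷ []) post)
    ... | inj₁ K∈ys | Keys⁺≡′ = ∈-insertAfter⁺ (target y) (cycle y) (go rs Keys⁺≡′ K∈ys u∈)
    ... | inj₂ (here refl) | Keys⁺≡′ =
      ∈-insertAfter⁺-inserted (target y) (cycle y) (target-∈-construct Keys⁺≡′ (go rs Keys⁺≡′)) u∈

  module _ (l σ : ℕ) (w : Word) (σw≢0 : ¬ IsZero (σ ∷ w)) where

    v : Word
    v = σ ∷ w ++ replicate l 0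

    precedes-in-zeros-predecessor : ∀ {pre K′ post a} → a < l → K′ ≡ replicate l 0 ++ σ ∷ w →
      Keys⁺ ≡ pre ++ K′ ∷ post → Precedes (rotL^ a K′) v (construct n (pre ∷ʳ K′))
    precedes-in-zeros-predecessor {pre} {post = post} {a} a<l refl Keys⁺≡
      rewrite construct-∷ʳ n pre (replicate l 0 ++ σ ∷ w) =
      precedes-insertAfter-inserted (target K′) (cycle K′) (target-∈-construct Keys⁺≡ (cycles-present Keys⁺≡))
        (subst (λ u → Precedes (rotL^ a K′) u (cycle K′)) rotL^l≡v
          (rotL^-precedes-in-cycle (σw≢0 ∘ ++⁻ʳ (replicate l 0)) a<l (leadingZeros-replicate-++ l (σ ∷ w))))
      where
      K′ = replicate l 0 ++ σ ∷ w
      rotL^l≡v : rotL^ l K′ ≡ v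
      rotL^l≡v = trans (cong (λ m → rotL^ m K′) (sym (length-replicate l))) (rotL^-++ (replicate l 0) (σ ∷ w))

    -- N bounds the letter sum of z, which decreasing the first nonzero letter lowers.
    target-precedes : ∀ N z → sum z < N → length z ≡ l → ¬ IsZero z → ∀ {pre K post} →
      K ≡ z ++ σ ∷ w → Keys⁺ ≡ pre ++ K ∷ post → Precedes (target K) v (construct n pre)
    target-precedes (suc N) z Σz≤N |z|≡l z≢0 {post = post} K≡ Keys⁺≡ with zeroView z
    ... | zeros m = ⊥-elim (z≢0 (IsZero-replicate m))
    ... | nonzero a t y with refl ← trans K≡ (++-assoc (replicate a 0) (suc t ∷ y) (σ ∷ w))
      with decrement-earlier a t (y ++ σ ∷ w) Keys⁺≡
    ...   | inj₁ K′≡0 =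
      ⊥-elim (σw≢0 (++⁻ʳ (replicate a 0 ++ t ∷ y) (subst IsZero (sym (++-assoc (replicate a 0) (t ∷ y) (σ ∷ w))) K′≡0)))
    ...   | inj₂ (K′≢0 , K′∈pre) with pre₁ , mid , refl ← ∈-∃++ K′∈pre
      rewrite target-rotL^ a t (y ++ σ ∷ w) =
      subst (λ Ks → Precedes _ v (construct n Ks)) (++-assoc pre₁ (K′ ∷ []) mid)
        (precedes-construct-++ n (pre₁ ∷ʳ K′) mid precedes-in-predecessor)
      where
      z′ = replicate a 0 ++ t ∷ y
      K′ = replicate a 0 ++ t ∷ y ++ σ ∷ w
      K′≡z′σw : K′ ≡ z′ ++ σ ∷ w
      K′≡z′σw = sym (++-assoc (replicate a 0) (t ∷ y) (σ ∷ w))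
      Keys⁺≡′ : Keys⁺ ≡ pre₁ ++ K′ ∷ (mid ++ (replicate a 0 ++ suc t ∷ y ++ σ ∷ w) ∷ post)
      Keys⁺≡′ = trans Keys⁺≡ (++-assoc pre₁ (K′ ∷ mid) _)
      |z′|≡l : length z′ ≡ l
      |z′|≡l = trans (length-decrement (replicate a 0) t (suc t) y) |z|≡l
      precedes-in-predecessor : Precedes (rotL^ a K′) v (construct n (pre₁ ∷ʳ K′))
      precedes-in-predecessor with All.all? (_≟ 0) z′
      ... | yes z′≡0 = precedes-in-zeros-predecessor (subst (a <_) |z|≡l (leadingZeros<length a t y))
            (trans K′≡z′σw (cong (_++ σ ∷ w) (IsZero⇒replicate z′≡0 |z′|≡l))) Keys⁺≡′
      ... | no z′≢0 = precedes-construct-∷ʳ n pre₁ K′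
            (target-precedes N z′ Σz′<N |z′|≡l z′≢0 K′≡z′σw Keys⁺≡′)
            (rotL^-∈-cycle K′≢0 (leadingZeros-replicate-++ a (t ∷ y ++ σ ∷ w)))
        where
        Σz′<N : sum z′ < N
        Σz′<N = subst₂ _≤_ (cong suc (sym (sum-zeros-++ a (t ∷ y)))) refl
                  (subst (_≤ N) (sum-zeros-++ a (suc t ∷ y)) (s≤s⁻¹ Σz≤N))

    cycle-precedes : ∀ z → length z ≡ l → ¬ IsZero z → z ++ σ ∷ w ∈ Keys⁺ →
      ∀ {u} → u ∈ cycle (z ++ σ ∷ w) → Precedes u v (construct n Keys⁺)
    cycle-precedes z |z|≡l z≢0 K∈ u∈ with pre , post , Keys⁺≡ ← ∈-∃++ K∈ =
      subst (Precedes _ v ∘ construct n) (trans (++-assoc pre (K ∷ []) post) (sym Keys⁺≡))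
        (precedes-construct-++ n (pre ∷ʳ K) post
          (precedes-construct-∷ʳ n pre K (target-precedes (suc (sum z)) z ≤-refl |z|≡l z≢0 refl Keys⁺≡) u∈))
      where K = z ++ σ ∷ w

lemma3 : (n k l σ : ℕ) (w z : List ℕ) → 1 ≤ n →
    length (replicate l 0 ++ σ ∷ w) ≡ n →
    IsKeyWord (replicate l 0 ++ σ ∷ w) →
    IsKeyWord (z ++ σ ∷ w) →
    length z ≡ l →
    z ≢ replicate l 0 →
    All (_< k) (z ++ σ ∷ w) →
    (u : List ℕ) → u ∈ cycle (z ++ σ ∷ w) →
    Before (D n k) u (σ ∷ w ++ replicate l 0)
lemma3 n zero l σ w z _ _ _ _ _ _ K<0 _ _ with () ∷ _ ← ++⁻ʳ z K<0
lemma3 n (suc k) l σ w z _ |M|≡n _ key |z|≡l z≢zeros K<k u u∈ =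
  precedes⇒Before (cycle-precedes l σ w σw≢0 z |z|≡l z≢0 (∈-Keys⁺⁺ |K|≡n K<k key (z≢0 ∘ ++⁻ˡ z)) u∈)
  where
  open KeyList n k
  z≢0 : ¬ IsZero z
  z≢0 z≡0 = z≢zeros (IsZero⇒replicate z≡0 |z|≡l)
  σw≢0 : ¬ IsZero (σ ∷ w)
  σw≢0 = z≢0 ∘ IsKeyWord-zero-suffix z σ w key
  |K|≡n : length (z ++ σ ∷ w) ≡ n
  |K|≡n = trans (length-++ z) (trans (cong (_+ length (σ ∷ w)) (trans |z|≡l (sym (length-replicate l))))
            (trans (sym (length-++ (replicate l 0))) |M|≡n))
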